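{- Let $R$ be an integral domain (with $2\in R^\times$), $G$ a profinite group, $T:G\to R$ a pseudo-representation, and $\alpha,\beta\in G$. 1) If $y(\alpha,\beta)=0$, then for every $\tau\in G$, either $y(\alpha,\tau)=0$ or $y(\tau,\beta)=0$. 2) If $J_\beta=\{\tau\in G:y(\beta,\tau)\ne0\}$ is non-empty, then $y(\alpha,\tau)/y(\beta,\tau)=y(\alpha,\tau')/y(\beta,\tau')$ in the fraction field of $R$ for all $\tau,\tau'\in J_\beta$; similarly, if $J'_\beta=\{\tau\in G:y(\tau,\beta)\ne0\}$ is non-empty, then $y(\tau,\alpha)/y(\tau,\beta)=y(\tau',\alpha)/y(\tau',\beta)$ for all $\tau,\tau'\in J'_\beta$.
   Context: For a profinite group $G$ with a fixed element $c$ of order $2$ and a topological commutative ring $R$ with $2\in R^\times$, a (2-dimensional) pseudo-representation is a continuous $T:G\to R$ with $T(1)=2$, $T(c)=0$, $T(\sigma\tau)=T(\tau\sigma)$, and $T(\gamma\delta\eta)+T(\gamma\eta\delta)-T(\gamma\eta)T(\delta)-T(\eta\delta)T(\gamma)-T(\delta\gamma)T(\eta)+T(\gamma)T(\delta)T(\eta)=0$ for all $\gamma,\delta,\eta\in G$. Put $a(\sigma)=\tfrac12(T(c\sigma)+T(\sigma))$ and $y(\sigma,\tau)=a(\sigma\tau)-a(\sigma)a(\tau)$. -}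

module Defs where

open import Level using (Level; _⊔_)
open import Algebra.Bundles using (Group; CommutativeRing)
open import Data.Sum using (_⊎_)
open import Relation.Nullary using (¬_)

record IsIntegralDomain {c ℓ : Level} (R : CommutativeRing c ℓ) : Set (c ⊔ ℓ) where
  open CommutativeRing R
  field
    1≉0            : ¬ (1# ≈ 0#)
    noZeroDivisors : ∀ x y → x * y ≈ 0# → x ≈ 0# ⊎ y ≈ 0#

IsInverseOfTwo : {c ℓ : Level} (R : CommutativeRing c ℓ) → CommutativeRing.Carrier R → Set ℓ
IsInverseOfTwo R h = (1# + 1#) * h ≈ 1#
  where open CommutativeRing R

module _ {g₁ g₂ r₁ r₂ : Level} (G : Group g₁ g₂) (R : CommutativeRing r₁ r₂) where
  private
    module G = Group G
    module R = CommutativeRing R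

  HasOrderTwo : G.Carrier → Set g₂
  HasOrderTwo c = ((c G.∙ c) G.≈ G.ε) Data.Product.× (¬ (c G.≈ G.ε))
    where import Data.Product

  -- 2-dimensional pseudo-representation T : G → R relative to c
  -- (T respects the setoid equality of G; continuity is dropped)
  record IsPseudoRep (c : G.Carrier) (T : G.Carrier → R.Carrier) : Set (g₁ ⊔ g₂ ⊔ r₂) where
    field
      T-cong : ∀ {x y} → x G.≈ y → T x R.≈ T y
      T-one  : T G.ε R.≈ (R.1# R.+ R.1#)
      T-c    : T c R.≈ R.0#
      T-comm : ∀ σ τ → T (σ G.∙ τ) R.≈ T (τ G.∙ σ)
      T-rel  : ∀ γ δ η →
        ((((T (γ G.∙ δ G.∙ η) R.+ T (γ G.∙ η G.∙ δ))
           R.- (T (γ G.∙ η) R.* T δ))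
           R.- (T (η G.∙ δ) R.* T γ))
           R.- (T (δ G.∙ γ) R.* T η))
           R.+ (T γ R.* T δ R.* T η)
        R.≈ R.0#

  a : (h : R.Carrier) (c : G.Carrier) (T : G.Carrier → R.Carrier) → G.Carrier → R.Carrier
  a h c T σ = h R.* (T (c G.∙ σ) R.+ T σ)

  y : (h : R.Carrier) (c : G.Carrier) (T : G.Carrier → R.Carrier) → G.Carrier → G.Carrier → R.Carrier
  y h c T σ τ = a h c T (σ G.∙ τ) R.- (a h c T σ R.* a h c T τ)

-- Extend T linearly to a trace form tr on the group algebra R[G]. It stays cyclic, and the
-- pseudo-representation identity, being trilinear, holds on all of R[G]. Since T(1) = 2 and
-- T(c) = 0, e = (1 + c)/2 and f = (1 − c)/2 are complementary idempotents of trace 1; for such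
-- an idempotent z the identity at (zpz, zqz, z) reads tr(zpzq) = tr(zp) tr(zq). As
-- a(σ) = tr(eσ), this gives y(σ,τ) = tr(eστ) − tr(eσeτ) = tr(eσfτ), and then
--   y(α,β) y(γ,δ) = tr(eαfβeγfδ) = tr(fβeγfδeα) = y(γ,β) y(α,δ).
-- All three statements are instances of this exchange identity, the first using that R is a domain.
module Submission where

open import Defs
open import Level using (Level; _⊔_)
open import Algebra.Bundles using (Group; CommutativeRing)
open import Data.Product using (_×_; _,_)
open import Data.Sum using (_⊎_)
open import Data.List using (List; []; _∷_; _++_; map)
open import Relation.Nullary using (¬_)
import Relation.Binary.Reasoning.Setoid as ≈-Reasoning
import Algebra.Properties.CommutativeSemigroup as CommutativeSemigroupProperties
import Algebra.Properties.AbelianGroup as AbelianGroupProperties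
import Algebra.Properties.Ring as RingProperties
import Algebra.Solver.CommutativeMonoid as CMSolver
import Algebra.Solver.Ring.NaturalCoefficients.Default as NCSolver

module FormalSums {g₁ g₂ r₁ r₂ : Level} (G : Group g₁ g₂) (R : CommutativeRing r₁ r₂) where

  open Group G using (_∙_) renaming (Carrier to E; _≈_ to _≈ᴳ_; assoc to ∙-assoc)
  open CommutativeRing R renaming (Carrier to K)
  open CommutativeSemigroupProperties +-commutativeSemigroup using () renaming (interchange to +-interchange)
  open AbelianGroupProperties +-abelianGroup using (⁻¹-∙-comm; ε⁻¹≈ε)

  -- An element of the group algebra R[G], as an unreduced list of terms r·g.
  Formal : Set (g₁ ⊔ r₁)
  Formal = List (K × E)

  ∑ : (K → E → K) → Formal → K
  ∑ f []            = 0#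
  ∑ f ((r , g) ∷ x) = f r g + ∑ f x

  leftMul : K → E → Formal → Formal
  leftMul r g = map (λ (s , k) → r * s , g ∙ k)

  infixl 7 _·_
  _·_ : Formal → Formal → Formal
  []            · y = []
  ((r , g) ∷ x) · y = leftMul r g y ++ x · y

  ∑-cong : ∀ {f f′} x → (∀ r g → f r g ≈ f′ r g) → ∑ f x ≈ ∑ f′ x
  ∑-cong []            f≈f′ = refl
  ∑-cong ((r , g) ∷ x) f≈f′ = +-cong (f≈f′ r g) (∑-cong x f≈f′)

  ∑-++ : ∀ f x y → ∑ f (x ++ y) ≈ ∑ f x + ∑ f y
  ∑-++ f []            y = sym (+-identityˡ _)
  ∑-++ f ((r , g) ∷ x) y = trans (+-congˡ (∑-++ f x y)) (sym (+-assoc _ _ _))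

  ∑-leftMul : ∀ f r g y → ∑ f (leftMul r g y) ≈ ∑ (λ s k → f (r * s) (g ∙ k)) y
  ∑-leftMul f r g []      = refl
  ∑-leftMul f r g (_ ∷ y) = +-congˡ (∑-leftMul f r g y)

  ∑-· : ∀ f x y → ∑ f (x · y) ≈ ∑ (λ r g → ∑ (λ s k → f (r * s) (g ∙ k)) y) x
  ∑-· f []            y = refl
  ∑-· f ((r , g) ∷ x) y = trans (∑-++ f (leftMul r g y) (x · y)) (+-cong (∑-leftMul f r g y) (∑-· f x y))

  ∑-zero : ∀ x → ∑ (λ _ _ → 0#) x ≈ 0#
  ∑-zero []      = refl
  ∑-zero (_ ∷ x) = trans (+-identityˡ _) (∑-zero x)

  ∑-distrib-+ : ∀ f f′ x → ∑ f x + ∑ f′ x ≈ ∑ (λ r g → f r g + f′ r g) x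
  ∑-distrib-+ f f′ []            = +-identityˡ 0#
  ∑-distrib-+ f f′ ((r , g) ∷ x) = trans (+-interchange _ _ _ _) (+-congˡ (∑-distrib-+ f f′ x))

  ∑-distrib-neg : ∀ f x → - ∑ f x ≈ ∑ (λ r g → - f r g) x
  ∑-distrib-neg f []            = ε⁻¹≈ε
  ∑-distrib-neg f ((r , g) ∷ x) = trans (sym (⁻¹-∙-comm _ _)) (+-congˡ (∑-distrib-neg f x))

  ∑-distrib-- : ∀ f f′ x → ∑ f x - ∑ f′ x ≈ ∑ (λ r g → f r g - f′ r g) x
  ∑-distrib-- f f′ x = trans (+-congˡ (∑-distrib-neg f′ x)) (∑-distrib-+ f _ x)

  *-distribˡ-∑ : ∀ a f x → a * ∑ f x ≈ ∑ (λ r g → a * f r g) x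
  *-distribˡ-∑ a f []            = zeroʳ a
  *-distribˡ-∑ a f ((r , g) ∷ x) = trans (distribˡ a _ _) (+-congˡ (*-distribˡ-∑ a f x))

  *-distribʳ-∑ : ∀ a f x → ∑ f x * a ≈ ∑ (λ r g → f r g * a) x
  *-distribʳ-∑ a f []            = zeroˡ a
  *-distribʳ-∑ a f ((r , g) ∷ x) = trans (distribʳ a _ _) (+-congˡ (*-distribʳ-∑ a f x))

  ∑-comm : ∀ (F : K → E → K → E → K) x y →
           ∑ (λ r g → ∑ (F r g) y) x ≈ ∑ (λ s k → ∑ (λ r g → F r g s k) x) y
  ∑-comm F []            y = sym (∑-zero y)
  ∑-comm F ((r , g) ∷ x) y = trans (+-congˡ (∑-comm F x y)) (∑-distrib-+ _ _ y)

  Congruent : (K → E → K) → Set (g₁ ⊔ g₂ ⊔ r₁ ⊔ r₂)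
  Congruent f = ∀ {r r′ g g′} → r ≈ r′ → g ≈ᴳ g′ → f r g ≈ f r′ g′

  ∑-·-assoc : ∀ f → Congruent f → ∀ x y z → ∑ f ((x · y) · z) ≈ ∑ f (x · (y · z))
  ∑-·-assoc f f-cong x y z = begin
    ∑ f ((x · y) · z)
      ≈⟨ trans (∑-· f (x · y) z) (∑-· _ x y) ⟩
    ∑ (λ r g → ∑ (λ s k → ∑ (λ t m → f ((r * s) * t) ((g ∙ k) ∙ m)) z) y) x
      ≈⟨ ∑-cong x (λ r g → ∑-cong y (λ s k → ∑-cong z (λ t m → f-cong (*-assoc r s t) (∙-assoc g k m)))) ⟩
    ∑ (λ r g → ∑ (λ s k → ∑ (λ t m → f (r * (s * t)) (g ∙ (k ∙ m))) z) y) x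
      ≈⟨ sym (trans (∑-· f x (y · z)) (∑-cong x (λ r g → ∑-· _ y z))) ⟩
    ∑ f (x · (y · z)) ∎
    where open ≈-Reasoning setoid

  ∑-*-∑ : ∀ f f′ x y → ∑ f x * ∑ f′ y ≈ ∑ (λ r g → ∑ (λ s k → f r g * f′ s k) y) x
  ∑-*-∑ f f′ x y = trans (*-distribʳ-∑ (∑ f′ y) f x) (∑-cong x (λ r g → *-distribˡ-∑ (f r g) f′ y))

  ⟨_⟩ : E → Formal
  ⟨ σ ⟩ = (1# , σ) ∷ []

module TraceForm {g₁ g₂ r₁ r₂ : Level} (G : Group g₁ g₂) (R : CommutativeRing r₁ r₂)
  (T : Group.Carrier G → CommutativeRing.Carrier R)
  (T-cong : ∀ {σ τ} → Group._≈_ G σ τ → CommutativeRing._≈_ R (T σ) (T τ))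
  (T-comm : ∀ σ τ → CommutativeRing._≈_ R (T (Group._∙_ G σ τ)) (T (Group._∙_ G τ σ))) where

  open Group G using (ε; _∙_; ∙-congʳ) renaming (Carrier to E; identityʳ to ∙-identityʳ)
  open CommutativeRing R renaming (Carrier to K)
  open FormalSums G R public

  tr : Formal → K
  tr = ∑ (λ r g → r * T g)

  tr-· : ∀ x y → tr (x · y) ≈ ∑ (λ r g → ∑ (λ s k → (r * s) * T (g ∙ k)) y) x
  tr-· = ∑-· _

  tr-·-by-right : ∀ x y → tr (x · y) ≈ ∑ (λ s k → ∑ (λ r g → (r * s) * T (g ∙ k)) x) y
  tr-·-by-right x y = trans (tr-· x y) (∑-comm _ x y)

  tr-·-assoc : ∀ x y z → tr ((x · y) · z) ≈ tr (x · (y · z))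
  tr-·-assoc = ∑-·-assoc _ (λ r≈r′ g≈g′ → *-cong r≈r′ (T-cong g≈g′))

  tr-·-comm : ∀ x y → tr (x · y) ≈ tr (y · x)
  tr-·-comm x y = begin
    tr (x · y)
      ≈⟨ tr-·-by-right x y ⟩
    ∑ (λ s k → ∑ (λ r g → (r * s) * T (g ∙ k)) x) y
      ≈⟨ ∑-cong y (λ s k → ∑-cong x (λ r g → *-cong (*-comm r s) (T-comm g k))) ⟩
    ∑ (λ s k → ∑ (λ r g → (s * r) * T (k ∙ g)) x) y
      ≈⟨ tr-· y x ⟨
    tr (y · x)
      ∎
    where open ≈-Reasoning setoid

  one : Formal
  one = (1# , ε) ∷ []

  tr-·-one : ∀ x → tr (x · one) ≈ tr x
  tr-·-one x = trans (∑-· _ x one)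
    (∑-cong x (λ r g → trans (+-identityʳ _) (*-cong (*-identityʳ r) (T-cong (∙-identityʳ g)))))

  -- Equality in R[G] modulo the kernel of the trace form: the list model of
  -- R[G] is associative and unital only up to this relation.
  infix 4 _≃_
  record _≃_ (x y : Formal) : Set (g₁ ⊔ r₁ ⊔ r₂) where
    constructor mk≃
    field tr-·ʳ : ∀ w → tr (x · w) ≈ tr (y · w)
  open _≃_

  ≃-sym : ∀ {x y} → x ≃ y → y ≃ x
  ≃-sym x≃y = mk≃ (λ w → sym (tr-·ʳ x≃y w))

  ≃-trans : ∀ {x y z} → x ≃ y → y ≃ z → x ≃ z
  ≃-trans x≃y y≃z = mk≃ (λ w → trans (tr-·ʳ x≃y w) (tr-·ʳ y≃z w))

  tr-cong : ∀ {x y} → x ≃ y → tr x ≈ tr y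
  tr-cong {x} {y} x≃y = trans (sym (tr-·-one x)) (trans (tr-·ʳ x≃y one) (tr-·-one y))

  ·-assoc : ∀ x y z → (x · y) · z ≃ x · (y · z)
  ·-assoc x y z = mk≃ (λ w → begin
    tr (((x · y) · z) · w)   ≈⟨ ∑-· _ ((x · y) · z) w ⟩
    ∑ (summand w) ((x · y) · z) ≈⟨ ∑-·-assoc (summand w) (summand-cong w) x y z ⟩
    ∑ (summand w) (x · (y · z)) ≈⟨ ∑-· _ (x · (y · z)) w ⟨
    tr ((x · (y · z)) · w)   ∎)
    where
    open ≈-Reasoning setoid
    summand : Formal → K → E → K
    summand w r g = ∑ (λ s k → (r * s) * T (g ∙ k)) w
    summand-cong : ∀ w → Congruent (summand w)
    summand-cong w r≈r′ g≈g′ = ∑-cong w (λ s k → *-cong (*-congʳ r≈r′) (T-cong (∙-congʳ g≈g′)))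

  ·-congʳ : ∀ {x y} z → x ≃ y → x · z ≃ y · z
  ·-congʳ {x} {y} z x≃y = mk≃ (λ w →
    trans (tr-·-assoc x z w) (trans (tr-·ʳ x≃y (z · w)) (sym (tr-·-assoc y z w))))

  ·-congˡ : ∀ {x y} z → x ≃ y → z · x ≃ z · y
  ·-congˡ {x} {y} z x≃y = mk≃ (λ w → begin
    tr ((z · x) · w)   ≈⟨ tr-·-assoc z x w ⟩
    tr (z · (x · w))   ≈⟨ tr-·-comm z (x · w) ⟩
    tr ((x · w) · z)   ≈⟨ tr-·-assoc x w z ⟩
    tr (x · (w · z))   ≈⟨ tr-·ʳ x≃y (w · z) ⟩
    tr (y · (w · z))   ≈⟨ tr-·-assoc y w z ⟨
    tr ((y · w) · z)   ≈⟨ tr-·-comm (y · w) z ⟩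
    tr (z · (y · w))   ≈⟨ tr-·-assoc z y w ⟨
    tr ((z · y) · w)   ∎)
    where open ≈-Reasoning setoid

  ·-identityˡ : ∀ x → one · x ≃ x
  ·-identityˡ x = mk≃ (λ w →
    trans (tr-·-assoc one x w) (trans (tr-·-comm one (x · w)) (tr-·-one (x · w))))

  ∏ : List Formal → Formal
  ∏ []       = one
  ∏ (x ∷ xs) = x · ∏ xs

  ∏-++ : ∀ xs ys → ∏ (xs ++ ys) ≃ ∏ xs · ∏ ys
  ∏-++ []       ys = ≃-sym (·-identityˡ (∏ ys))
  ∏-++ (x ∷ xs) ys = ≃-trans (·-congˡ x (∏-++ xs ys)) (≃-sym (·-assoc x (∏ xs) (∏ ys)))

  tr-∏-rotate : ∀ xs ys → tr (∏ (xs ++ ys)) ≈ tr (∏ (ys ++ xs))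
  tr-∏-rotate xs ys = trans (tr-cong (∏-++ xs ys))
    (trans (tr-·-comm (∏ xs) (∏ ys)) (sym (tr-cong (∏-++ ys xs))))

pseudoRepDefect : ∀ {a r₁ r₂} (R : CommutativeRing r₁ r₂) {A : Set a} →
                  (A → CommutativeRing.Carrier R) → (A → A → A) → A → A → A → CommutativeRing.Carrier R
pseudoRepDefect R t _⊙_ γ δ η =
  ((((t ((γ ⊙ δ) ⊙ η) + t ((γ ⊙ η) ⊙ δ)) - t (γ ⊙ η) * t δ) - t (η ⊙ δ) * t γ) - t (δ ⊙ γ) * t η)
    + t γ * t δ * t η
  where open CommutativeRing R

module PseudoCharacter {g₁ g₂ r₁ r₂ : Level} (G : Group g₁ g₂) (R : CommutativeRing r₁ r₂)
  {c : Group.Carrier G} {T : Group.Carrier G → CommutativeRing.Carrier R} (PR : IsPseudoRep G R c T) where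

  open Group G using (_∙_) renaming (Carrier to E)
  open CommutativeRing R renaming (Carrier to K)
  open IsPseudoRep PR
  open TraceForm G R T T-cong T-comm public
  open RingProperties ring using (x[y-z]≈xy-xz; x∙y⁻¹≈ε⇒x≈y)

  private
    minus-cong : ∀ {a a′ b b′} → a ≈ a′ → b ≈ b′ → a - b ≈ a′ - b′
    minus-cong a≈a′ b≈b′ = +-cong a≈a′ (-‿cong b≈b′)

  ∑³ : (K → E → K → E → K → E → K) → Formal → Formal → Formal → K
  ∑³ F x y z = ∑ (λ r g → ∑ (λ s k → ∑ (F r g s k) z) y) x

  ∑³-cong : ∀ {F F′} x y z → (∀ r g s k t m → F r g s k t m ≈ F′ r g s k t m) →
            ∑³ F x y z ≈ ∑³ F′ x y z
  ∑³-cong x y z F≈F′ = ∑-cong x (λ r g → ∑-cong y (λ s k → ∑-cong z (F≈F′ r g s k)))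

  ∑³-zero : ∀ x y z → ∑³ (λ _ _ _ _ _ _ → 0#) x y z ≈ 0#
  ∑³-zero x y z = trans (∑-cong x (λ r g → trans (∑-cong y (λ s k → ∑-zero z)) (∑-zero y))) (∑-zero x)

  ∑³-distrib-+ : ∀ F F′ x y z →
                 ∑³ F x y z + ∑³ F′ x y z ≈ ∑³ (λ r g s k t m → F r g s k t m + F′ r g s k t m) x y z
  ∑³-distrib-+ F F′ x y z = trans (∑-distrib-+ _ _ x)
    (∑-cong x (λ r g → trans (∑-distrib-+ _ _ y) (∑-cong y (λ s k → ∑-distrib-+ _ _ z))))

  ∑³-distrib-- : ∀ F F′ x y z →
                 ∑³ F x y z - ∑³ F′ x y z ≈ ∑³ (λ r g s k t m → F r g s k t m - F′ r g s k t m) x y z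
  ∑³-distrib-- F F′ x y z = trans (∑-distrib-- _ _ x)
    (∑-cong x (λ r g → trans (∑-distrib-- _ _ y) (∑-cong y (λ s k → ∑-distrib-- _ _ z))))

  tr-·-· : ∀ x y z → tr ((x · y) · z) ≈ ∑³ (λ r g s k t m → ((r * s) * t) * T ((g ∙ k) ∙ m)) x y z
  tr-·-· x y z = trans (∑-· _ (x · y) z) (∑-· _ x y)

  private
    pull-factor : ∀ ρ a₁ a₂ a₃ a₄ a₅ a₆ → ((((ρ * a₁ + ρ * a₂) - ρ * a₃) - ρ * a₄) - ρ * a₅) + ρ * a₆
                                          ≈ ρ * (((((a₁ + a₂) - a₃) - a₄) - a₅) + a₆)
    pull-factor ρ a₁ a₂ a₃ a₄ a₅ a₆ = sym (trans (distribˡ ρ _ a₆) (+-congʳ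
      (trans (x[y-z]≈xy-xz ρ _ a₅) (minus-cong (trans (x[y-z]≈xy-xz ρ _ a₄) (minus-cong
        (trans (x[y-z]≈xy-xz ρ _ a₃) (minus-cong (distribˡ ρ a₁ a₂) refl)) refl)) refl))))

  defect-monomial : ∀ r g s k t m →
    ((((((r * s) * t) * T ((g ∙ k) ∙ m) + ((r * t) * s) * T ((g ∙ m) ∙ k)) - ((r * t) * T (g ∙ m)) * (s * T k))
      - (r * T g) * ((t * s) * T (m ∙ k))) - ((s * r) * T (k ∙ g)) * (t * T m)) + (r * T g) * ((s * T k) * (t * T m))
    ≈ ((r * s) * t) * pseudoRepDefect R T _∙_ g k m
  defect-monomial r g s k t m = trans
    (+-cong (minus-cong (minus-cong (minus-cong (+-congˡ
      (solve 4 (λ r s t X → ((r ⊕ t) ⊕ s) ⊕ X ⊜ ((r ⊕ s) ⊕ t) ⊕ X) refl r s t _))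
      (solve 5 (λ r s t X Y → ((r ⊕ t) ⊕ X) ⊕ (s ⊕ Y) ⊜ ((r ⊕ s) ⊕ t) ⊕ (X ⊕ Y)) refl r s t _ _))
      (solve 5 (λ r s t X Y → (r ⊕ Y) ⊕ ((t ⊕ s) ⊕ X) ⊜ ((r ⊕ s) ⊕ t) ⊕ (X ⊕ Y)) refl r s t _ _))
      (solve 5 (λ r s t X Y → ((s ⊕ r) ⊕ X) ⊕ (t ⊕ Y) ⊜ ((r ⊕ s) ⊕ t) ⊕ (X ⊕ Y)) refl r s t _ _))
      (solve 6 (λ r s t X Y Z → (r ⊕ X) ⊕ ((s ⊕ Y) ⊕ (t ⊕ Z)) ⊜ ((r ⊕ s) ⊕ t) ⊕ ((X ⊕ Y) ⊕ Z)) refl r s t _ _ _))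
    (pull-factor ((r * s) * t) _ _ _ _ _ _)
    where open CMSolver *-commutativeMonoid using (solve; _⊕_; _⊜_)

  tr-defect-expand : ∀ x y z → pseudoRepDefect R tr _·_ x y z
                     ≈ ∑³ (λ r g s k t m → ((r * s) * t) * pseudoRepDefect R T _∙_ g k m) x y z
  tr-defect-expand x y z = begin
    pseudoRepDefect R tr _·_ x y z
      ≈⟨ +-cong (minus-cong (minus-cong (minus-cong (+-cong (tr-·-· x y z) term₂) term₃) term₄) term₅) term₆ ⟩
    ((((∑³ A₁ x y z + ∑³ A₂ x y z) - ∑³ A₃ x y z) - ∑³ A₄ x y z) - ∑³ A₅ x y z) + ∑³ A₆ x y z
      ≈⟨ trans (+-congʳ (trans (minus-cong (trans (minus-cong (trans (minus-cong
                 (∑³-distrib-+ A₁ A₂ x y z) refl)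
                 (∑³-distrib-- _ A₃ x y z)) refl)
                 (∑³-distrib-- _ A₄ x y z)) refl)
                 (∑³-distrib-- _ A₅ x y z)))
               (∑³-distrib-+ _ A₆ x y z) ⟩
    ∑³ combination x y z
      ≈⟨ ∑³-cong x y z defect-monomial ⟩
    ∑³ (λ r g s k t m → ((r * s) * t) * pseudoRepDefect R T _∙_ g k m) x y z ∎
    where
    open ≈-Reasoning setoid
    A₁ A₂ A₃ A₄ A₅ A₆ : K → E → K → E → K → E → K
    A₁ r g s k t m = ((r * s) * t) * T ((g ∙ k) ∙ m)
    A₂ r g s k t m = ((r * t) * s) * T ((g ∙ m) ∙ k)
    A₃ r g s k t m = ((r * t) * T (g ∙ m)) * (s * T k)
    A₄ r g s k t m = (r * T g) * ((t * s) * T (m ∙ k))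
    A₅ r g s k t m = ((s * r) * T (k ∙ g)) * (t * T m)
    A₆ r g s k t m = (r * T g) * ((s * T k) * (t * T m))
    combination : K → E → K → E → K → E → K
    combination r g s k t m =
      ((((A₁ r g s k t m + A₂ r g s k t m) - A₃ r g s k t m) - A₄ r g s k t m) - A₅ r g s k t m) + A₆ r g s k t m
    term₂ : tr ((x · z) · y) ≈ ∑³ A₂ x y z
    term₂ = trans (tr-·-· x z y) (∑-cong x (λ r g → ∑-comm _ z y))
    term₃ : tr (x · z) * tr y ≈ ∑³ A₃ x y z
    term₃ = trans (*-congʳ (tr-· x z)) (trans (∑-*-∑ _ _ x y)
      (∑-cong x (λ r g → ∑-cong y (λ s k → *-distribʳ-∑ _ _ z))))
    term₄ : tr (z · y) * tr x ≈ ∑³ A₄ x y z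
    term₄ = trans (*-comm _ _) (trans (*-congˡ (tr-·-by-right z y)) (trans (∑-*-∑ _ _ x y)
      (∑-cong x (λ r g → ∑-cong y (λ s k → *-distribˡ-∑ _ _ z)))))
    term₅ : tr (y · x) * tr z ≈ ∑³ A₅ x y z
    term₅ = trans (*-congʳ (tr-·-by-right y x)) (trans (*-distribʳ-∑ _ _ x)
      (∑-cong x (λ r g → ∑-*-∑ _ _ y z)))
    term₆ : tr x * tr y * tr z ≈ ∑³ A₆ x y z
    term₆ = trans (*-assoc _ _ _) (trans (*-congˡ (∑-*-∑ _ _ y z)) (trans (∑-*-∑ _ _ x y)
      (∑-cong x (λ r g → ∑-cong y (λ s k → *-distribˡ-∑ _ _ z)))))

  tr-defect : ∀ x y z → pseudoRepDefect R tr _·_ x y z ≈ 0#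
  tr-defect x y z = trans (tr-defect-expand x y z)
    (trans (∑³-cong x y z (λ r g s k t m → trans (*-congˡ (T-rel g k m)) (zeroʳ _))) (∑³-zero x y z))

  private
    x+x-y-w-x+y≈x-w : ∀ x y w → ((((x + x) - y) - w) - x) + y ≈ x - w
    x+x-y-w-x+y≈x-w x y w = begin
      ((((x + x) - y) - w) - x) + y
        ≈⟨ solve 5 (λ x y x′ y′ w′ → ((((x ⊕ x) ⊕ y′) ⊕ w′) ⊕ x′) ⊕ y ⊜ (x ⊕ w′) ⊕ ((x ⊕ x′) ⊕ (y ⊕ y′)))
                   refl x y (- x) (- y) (- w) ⟩
      (x - w) + ((x - x) + (y - y))  ≈⟨ +-congˡ (trans (+-cong (-‿inverseʳ x) (-‿inverseʳ y)) (+-identityʳ 0#)) ⟩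
      (x - w) + 0#                   ≈⟨ +-identityʳ _ ⟩
      x - w                          ∎
      where
      open ≈-Reasoning setoid
      open CMSolver +-commutativeMonoid using (solve; _⊕_; _⊜_)

  tr-corner : ∀ z → z · z ≃ z → tr z ≈ 1# → ∀ p q → tr (((z · p) · z) · q) ≈ tr (z · p) * tr (z · q)
  tr-corner z zz≃z trz≈1 p q = begin
    tr (((z · p) · z) · q)  ≈⟨ corner≈ p q ⟨
    X                       ≈⟨ x∙y⁻¹≈ε⇒x≈y X (Q * P) (trans (sym collapse) (tr-defect p′ q′ z)) ⟩
    Q * P                   ≈⟨ *-comm Q P ⟩
    P * Q                   ≈⟨ *-cong (sandwich p) (sandwich q) ⟩
    tr (z · p) * tr (z · q) ∎
    where
    open ≈-Reasoning setoid
    absorbʳ : ∀ u → ((z · u) · z) · z ≃ (z · u) · z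
    absorbʳ u = ≃-trans (·-assoc (z · u) z z) (·-congˡ (z · u) zz≃z)
    absorbˡ : ∀ u → z · ((z · u) · z) ≃ (z · u) · z
    absorbˡ u = ≃-trans (≃-sym (·-assoc z (z · u) z)) (·-congʳ z (≃-trans (≃-sym (·-assoc z z u)) (·-congʳ u zz≃z)))
    p′ q′ : Formal
    p′ = (z · p) · z
    q′ = (z · q) · z
    X P Q : K
    X = tr (p′ · q′)
    P = tr p′
    Q = tr q′
    sandwich : ∀ u → tr ((z · u) · z) ≈ tr (z · u)
    sandwich u = trans (tr-·-comm (z · u) z) (trans (sym (tr-·-assoc z z u)) (tr-cong (·-congʳ u zz≃z)))
    corner≈ : ∀ u v → tr (((z · u) · z) · ((z · v) · z)) ≈ tr (((z · u) · z) · v)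
    corner≈ u v = begin
      tr (u′ · ((z · v) · z))  ≈⟨ tr-·-comm u′ _ ⟩
      tr (((z · v) · z) · u′)  ≈⟨ tr-·-assoc (z · v) z u′ ⟩
      tr ((z · v) · (z · u′))  ≈⟨ tr-cong (·-congˡ (z · v) (absorbˡ u)) ⟩
      tr ((z · v) · u′)        ≈⟨ tr-·-comm (z · v) u′ ⟩
      tr (u′ · (z · v))        ≈⟨ tr-·-assoc u′ z v ⟨
      tr ((u′ · z) · v)        ≈⟨ tr-cong (·-congʳ v (absorbʳ u)) ⟩
      tr (u′ · v)              ∎
      where u′ = (z · u) · z
    collapse : pseudoRepDefect R tr _·_ p′ q′ z ≈ X - Q * P
    collapse = begin
      pseudoRepDefect R tr _·_ p′ q′ z
        ≈⟨ +-cong (minus-cong (minus-cong (minus-cong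
             (+-cong (trans (tr-·-assoc p′ q′ z) (tr-cong (·-congˡ p′ (absorbʳ q))))
                     (tr-cong (·-congʳ q′ (absorbʳ p))))
             (*-congʳ (tr-cong (absorbʳ p))))
             (*-congʳ (tr-cong (absorbˡ q))))
             (trans (*-cong (tr-·-comm q′ p′) trz≈1) (*-identityʳ X)))
             (trans (*-congˡ trz≈1) (*-identityʳ _)) ⟩
      ((((X + X) - P * Q) - Q * P) - X) + P * Q
        ≈⟨ x+x-y-w-x+y≈x-w X (P * Q) (Q * P) ⟩
      X - Q * P ∎

  tr-∏-corner : ∀ z → z · z ≃ z → tr z ≈ 1# → ∀ ps qs →
                tr (∏ (z ∷ ps ++ z ∷ qs)) ≈ tr (∏ (z ∷ ps)) * tr (∏ (z ∷ qs))
  tr-∏-corner z zz≃z trz≈1 ps qs = trans (tr-cong regroup) (tr-corner z zz≃z trz≈1 (∏ ps) (∏ qs))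
    where
    regroup : ∏ (z ∷ ps ++ z ∷ qs) ≃ ((z · ∏ ps) · z) · ∏ qs
    regroup = ≃-trans (·-congˡ z (∏-++ ps (z ∷ qs)))
      (≃-sym (≃-trans (·-assoc (z · ∏ ps) z (∏ qs)) (·-assoc z (∏ ps) (z · ∏ qs))))

module OrthogonalIdempotents {g₁ g₂ r₁ r₂ : Level} (G : Group g₁ g₂) (R : CommutativeRing r₁ r₂)
  (h : CommutativeRing.Carrier R) (2h≈1 : IsInverseOfTwo R h)
  (c : Group.Carrier G) (c²≈ε : Group._≈_ G (Group._∙_ G c c) (Group.ε G))
  {T : Group.Carrier G → CommutativeRing.Carrier R} (PR : IsPseudoRep G R c T) where

  open Group G using (ε; _∙_; ∙-congˡ; ∙-congʳ)
    renaming (Carrier to E; trans to ≈ᴳ-trans; identityˡ to ∙-identityˡ; identityʳ to ∙-identityʳ)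
  open CommutativeRing R renaming (Carrier to K)
  open IsPseudoRep PR
  open PseudoCharacter G R PR
  open NCSolver commutativeSemiring using (solve; _:=_; _:+_; _:*_; con)

  h+h≈1 : h + h ≈ 1#
  h+h≈1 = trans (sym (trans (distribʳ h 1# 1#) (+-cong (*-identityˡ h) (*-identityˡ h)))) 2h≈1

  halfSum : K → Formal
  halfSum n = (h , ε) ∷ (n , c) ∷ []

  e f : Formal
  e = halfSum h
  f = halfSum (- h)

  halfSum-idempotent : ∀ n → n * n ≈ h * h → halfSum n · halfSum n ≃ halfSum n
  halfSum-idempotent n n²≈h² = mk≃ (λ w → trans (tr-·-by-right (halfSum n · halfSum n) w)
    (trans (∑-cong w pointwise) (sym (tr-·-by-right (halfSum n) w))))
    where
    pointwise : ∀ t m →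
      ((h * h) * t) * T ((ε ∙ ε) ∙ m) + (((h * n) * t) * T ((ε ∙ c) ∙ m) + (((n * h) * t) * T ((c ∙ ε) ∙ m)
        + (((n * n) * t) * T ((c ∙ c) ∙ m) + 0#))) ≈ (h * t) * T (ε ∙ m) + ((n * t) * T (c ∙ m) + 0#)
    pointwise t m = begin
      _ ≈⟨ +-cong (*-congˡ (T-cong (∙-congʳ (∙-identityˡ ε))))
             (+-cong (*-congˡ (T-cong (∙-congʳ (∙-identityˡ c))))
               (+-cong (*-congˡ (T-cong (∙-congʳ (∙-identityʳ c))))
                 (+-congʳ (*-cong (*-congʳ n²≈h²) (T-cong (∙-congʳ c²≈ε)))))) ⟩
      ((h * h) * t) * X + (((h * n) * t) * Y + (((n * h) * t) * Y + (((h * h) * t) * X + 0#)))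
        ≈⟨ solve 5 (λ h n t X Y →
             ((h :* h) :* t) :* X :+ (((h :* n) :* t) :* Y :+ (((n :* h) :* t) :* Y
               :+ (((h :* h) :* t) :* X :+ con 0)))
             := (((h :+ h) :* h) :* t) :* X :+ ((((h :+ h) :* n) :* t) :* Y :+ con 0)) refl h n t X Y ⟩
      (((h + h) * h) * t) * X + ((((h + h) * n) * t) * Y + 0#)
        ≈⟨ +-cong (*-congʳ (*-congʳ (halve h))) (+-congʳ (*-congʳ (*-congʳ (halve n)))) ⟩
      (h * t) * X + ((n * t) * Y + 0#) ∎
      where
      open ≈-Reasoning setoid
      X Y : K
      X = T (ε ∙ m)
      Y = T (c ∙ m)
      halve : ∀ u → (h + h) * u ≈ u
      halve u = trans (*-congʳ h+h≈1) (*-identityˡ u)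

  tr-halfSum : ∀ n → tr (halfSum n) ≈ 1#
  tr-halfSum n = trans (+-cong (*-congˡ T-one) (trans (+-identityʳ _) (trans (*-congˡ T-c) (zeroʳ n))))
                       (trans (+-identityʳ _) (trans (*-comm h _) 2h≈1))

  e·e≃e : e · e ≃ e
  e·e≃e = halfSum-idempotent h refl

  f·f≃f : f · f ≃ f
  f·f≃f = halfSum-idempotent (- h) -h*-h≈h*h
    where
    open RingProperties ring using (-‿distribˡ-*; -‿distribʳ-*; -‿involutive)
    -h*-h≈h*h : - h * - h ≈ h * h
    -h*-h≈h*h = trans (sym (-‿distribˡ-* h (- h))) (trans (-‿cong (sym (-‿distribʳ-* h h))) (-‿involutive _))

  tr-f·+tr-e· : ∀ w → tr (f · w) + tr (e · w) ≈ tr w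
  tr-f·+tr-e· w = trans (+-cong (tr-·-by-right f w) (tr-·-by-right e w))
    (trans (∑-distrib-+ _ _ w) (∑-cong w pointwise))
    where
    pointwise : ∀ t m →
      ((h * t) * T (ε ∙ m) + ((- h * t) * T (c ∙ m) + 0#)) + ((h * t) * T (ε ∙ m) + ((h * t) * T (c ∙ m) + 0#))
      ≈ t * T m
    pointwise t m = begin
      _ ≈⟨ solve 5 (λ h n t X Y →
             ((h :* t) :* X :+ ((n :* t) :* Y :+ con 0)) :+ ((h :* t) :* X :+ ((h :* t) :* Y :+ con 0))
             := ((h :+ h) :* t) :* X :+ ((n :+ h) :* t) :* Y) refl h (- h) t (T (ε ∙ m)) (T (c ∙ m)) ⟩
      ((h + h) * t) * T (ε ∙ m) + ((- h + h) * t) * T (c ∙ m)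
        ≈⟨ +-cong (*-congʳ (*-congʳ h+h≈1)) (trans (*-congʳ (trans (*-congʳ (-‿inverseˡ h)) (zeroˡ t))) (zeroˡ _)) ⟩
      (1# * t) * T (ε ∙ m) + 0#
        ≈⟨ trans (+-identityʳ _) (*-cong (*-identityˡ t) (T-cong (∙-identityˡ m))) ⟩
      t * T m ∎
      where open ≈-Reasoning setoid

  tr-∏-split : ∀ xs ys → tr (∏ (xs ++ f ∷ ys)) + tr (∏ (xs ++ e ∷ ys)) ≈ tr (∏ (xs ++ ys))
  tr-∏-split xs ys = trans (+-cong (tr-∏-rotate xs (f ∷ ys)) (tr-∏-rotate xs (e ∷ ys)))
    (trans (tr-f·+tr-e· (∏ (ys ++ xs))) (tr-∏-rotate ys xs))

  private
    a′ : E → K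
    a′ = a G R h c T
    y′ : E → E → K
    y′ = y G R h c T
    expansion : ∀ {k X Y X′ Y′} → k ≈ h → X ≈ X′ → Y ≈ Y′ → k * X + (k * Y + 0#) ≈ h * (Y′ + X′)
    expansion k≈h X≈X′ Y≈Y′ = trans (+-cong (*-cong k≈h X≈X′) (trans (+-identityʳ _) (*-cong k≈h Y≈Y′)))
                                    (trans (+-comm _ _) (sym (distribˡ h _ _)))

  tr-∏-e⟨⟩ : ∀ σ → tr (∏ (e ∷ ⟨ σ ⟩ ∷ [])) ≈ a′ σ
  tr-∏-e⟨⟩ σ = expansion (trans (*-congˡ (*-identityˡ 1#)) (*-identityʳ h))
    (T-cong (≈ᴳ-trans (∙-identityˡ _) (∙-identityʳ σ))) (T-cong (∙-congˡ (∙-identityʳ σ)))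

  tr-∏-e⟨⟩⟨⟩ : ∀ σ τ → tr (∏ (e ∷ ⟨ σ ⟩ ∷ ⟨ τ ⟩ ∷ [])) ≈ a′ (σ ∙ τ)
  tr-∏-e⟨⟩⟨⟩ σ τ = expansion (trans (*-congˡ (trans (*-identityˡ _) (*-identityˡ 1#))) (*-identityʳ h))
    (T-cong (≈ᴳ-trans (∙-identityˡ _) (∙-congˡ (∙-identityʳ τ)))) (T-cong (∙-congˡ (∙-congˡ (∙-identityʳ τ))))

  -- For a representation in a basis diagonalising c, this is the (1,2) entry of σ times the (2,1) entry of τ.
  ỹ : E → E → K
  ỹ σ τ = tr (∏ (e ∷ ⟨ σ ⟩ ∷ f ∷ ⟨ τ ⟩ ∷ []))

  y≈ỹ : ∀ σ τ → y′ σ τ ≈ ỹ σ τ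
  y≈ỹ σ τ = begin
    a′ (σ ∙ τ) - a′ σ * a′ τ  ≈⟨ +-cong (sym split) (-‿cong (sym corner)) ⟩
    (ỹ σ τ + P) - P           ≈⟨ +-assoc _ P (- P) ⟩
    ỹ σ τ + (P - P)           ≈⟨ +-congˡ (-‿inverseʳ P) ⟩
    ỹ σ τ + 0#                ≈⟨ +-identityʳ _ ⟩
    ỹ σ τ                     ∎
    where
    open ≈-Reasoning setoid
    P : K
    P = tr (∏ (e ∷ ⟨ σ ⟩ ∷ e ∷ ⟨ τ ⟩ ∷ []))
    split : ỹ σ τ + P ≈ a′ (σ ∙ τ)
    split = trans (tr-∏-split (e ∷ ⟨ σ ⟩ ∷ []) (⟨ τ ⟩ ∷ [])) (tr-∏-e⟨⟩⟨⟩ σ τ)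
    corner : P ≈ a′ σ * a′ τ
    corner = trans (tr-∏-corner e e·e≃e (tr-halfSum h) (⟨ σ ⟩ ∷ []) (⟨ τ ⟩ ∷ []))
                   (*-cong (tr-∏-e⟨⟩ σ) (tr-∏-e⟨⟩ τ))

  ỹ-exchange : ∀ α β γ δ → ỹ α β * ỹ γ δ ≈ ỹ γ β * ỹ α δ
  ỹ-exchange α β γ δ = begin
    ỹ α β * ỹ γ δ
      ≈⟨ tr-∏-corner e e·e≃e (tr-halfSum h) (⟨ α ⟩ ∷ f ∷ ⟨ β ⟩ ∷ []) (⟨ γ ⟩ ∷ f ∷ ⟨ δ ⟩ ∷ []) ⟨
    tr (∏ (e ∷ ⟨ α ⟩ ∷ f ∷ ⟨ β ⟩ ∷ e ∷ ⟨ γ ⟩ ∷ f ∷ ⟨ δ ⟩ ∷ []))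
      ≈⟨ tr-∏-rotate (e ∷ ⟨ α ⟩ ∷ []) (f ∷ ⟨ β ⟩ ∷ e ∷ ⟨ γ ⟩ ∷ f ∷ ⟨ δ ⟩ ∷ []) ⟩
    tr (∏ (f ∷ ⟨ β ⟩ ∷ e ∷ ⟨ γ ⟩ ∷ f ∷ ⟨ δ ⟩ ∷ e ∷ ⟨ α ⟩ ∷ []))
      ≈⟨ tr-∏-corner f f·f≃f (tr-halfSum (- h)) (⟨ β ⟩ ∷ e ∷ ⟨ γ ⟩ ∷ []) (⟨ δ ⟩ ∷ e ∷ ⟨ α ⟩ ∷ []) ⟩
    tr (∏ (f ∷ ⟨ β ⟩ ∷ e ∷ ⟨ γ ⟩ ∷ [])) * tr (∏ (f ∷ ⟨ δ ⟩ ∷ e ∷ ⟨ α ⟩ ∷ []))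
      ≈⟨ *-cong (tr-∏-rotate (f ∷ ⟨ β ⟩ ∷ []) (e ∷ ⟨ γ ⟩ ∷ [])) (tr-∏-rotate (f ∷ ⟨ δ ⟩ ∷ []) (e ∷ ⟨ α ⟩ ∷ [])) ⟩
    ỹ γ β * ỹ α δ
      ∎
    where open ≈-Reasoning setoid

  y-exchange : ∀ α β γ δ → y G R h c T α β * y G R h c T γ δ ≈ y G R h c T α δ * y G R h c T γ β
  y-exchange α β γ δ = begin
    y′ α β * y′ γ δ  ≈⟨ *-cong (y≈ỹ α β) (y≈ỹ γ δ) ⟩
    ỹ α β * ỹ γ δ    ≈⟨ ỹ-exchange α β γ δ ⟩
    ỹ γ β * ỹ α δ    ≈⟨ *-comm _ _ ⟩
    ỹ α δ * ỹ γ β    ≈⟨ *-cong (y≈ỹ α δ) (y≈ỹ γ β) ⟨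
    y′ α δ * y′ γ β  ∎
    where open ≈-Reasoning setoid

open CommutativeRing using (_≈_; _*_; 0#)

proposition2p2 : {g₁ g₂ r₁ r₂ : Level} (G : Group g₁ g₂) (R : CommutativeRing r₁ r₂) →
    IsIntegralDomain R →
    (h : CommutativeRing.Carrier R) → IsInverseOfTwo R h →
    (c : Group.Carrier G) → HasOrderTwo G R c →
    (T : Group.Carrier G → CommutativeRing.Carrier R) → IsPseudoRep G R c T →
    (α β : Group.Carrier G) →
    ((_≈_ R (y G R h c T α β) (0# R) →
        ∀ τ → _≈_ R (y G R h c T α τ) (0# R) ⊎ _≈_ R (y G R h c T τ β) (0# R))
    × (∀ τ τ' → ¬ _≈_ R (y G R h c T β τ) (0# R) → ¬ _≈_ R (y G R h c T β τ') (0# R) →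
         _≈_ R (_*_ R (y G R h c T α τ) (y G R h c T β τ'))
               (_*_ R (y G R h c T α τ') (y G R h c T β τ)))
    × (∀ τ τ' → ¬ _≈_ R (y G R h c T τ β) (0# R) → ¬ _≈_ R (y G R h c T τ' β) (0# R) →
         _≈_ R (_*_ R (y G R h c T τ α) (y G R h c T τ' β))
               (_*_ R (y G R h c T τ' α) (y G R h c T τ β))))
proposition2p2 G R domain h 2h≈1 c (c²≈ε , _) T PR α β =
  (λ yαβ≈0 τ → noZeroDivisors _ _ (trans (y-exchange α τ τ β) (trans (*-congʳ yαβ≈0) (zeroˡ _)))) ,
  -- The ratios are cross-multiplied.
  (λ τ τ′ _ _ → y-exchange α τ β τ′) ,
  (λ τ τ′ _ _ → trans (y-exchange τ α τ′ β) (*-comm _ _))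
  where
  open CommutativeRing R using (trans; *-congʳ; *-comm; zeroˡ)
  open IsIntegralDomain domain using (noZeroDivisors)
  open OrthogonalIdempotents G R h 2h≈1 c c²≈ε PR using (y-exchange)
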